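{- Let $\Gamma$ be a distance-biregular graph with color classes $Y,Y'$ and $D\ge 3$. For every integer $i$ with $1\le i\le\min\{D-1,D'-1\}$: $c'_{i+1}=c_i$ if and only if $c_{i+1}=c'_i$; and $c'_{i+1}>c_i$ if and only if $c_{i+1}>c'_i$.
   Context: All graphs are finite, simple and connected. $\Gamma_i(x)$ is the set of vertices at distance $i$ from $x$. A vertex $x$ is distance-regularized if for every $i$ the numbers $|\Gamma_{i-1}(x)\cap\Gamma_1(y)|$, $|\Gamma_i(x)\cap\Gamma_1(y)|$, $|\Gamma_{i+1}(x)\cap\Gamma_1(y)|$ depend only on $i$, not on $y\in\Gamma_i(x)$. A distance-biregular graph with color classes $Y,Y'$ is a bipartite graph with bipartition $(Y,Y')$ in which every vertex is distance-regularized, vertices in the same color class have the same intersection numbers, and vertices in different classes have different intersection arrays. $D$ (resp. $D'$) is the eccentricity of vertices of $Y$ (resp. $Y'$). For $x\in Y$, $z\in\Gamma_i(x)$: $c_i=|\Gamma_{i-1}(x)\cap\Gamma_1(z)|$; $c_i'$ is defined the same way for $x\in Y'$. -}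

module Defs where

open import Data.Nat using (ℕ; zero; suc; _≤_; _<_; _∸_)
open import Data.Bool using (Bool; true; false; _∧_; _∨_; not)
open import Data.Fin using (Fin; _≟_)
open import Data.List using (List; length; filterᵇ; allFin)
open import Data.Bool.ListAction using (any)
open import Data.Product using (Σ; ∃; _×_)
open import Relation.Nullary using (¬_; ⌊_⌋)
open import Relation.Binary.PropositionalEquality using (_≡_; _≢_)

reach : {n : ℕ} → (Fin n → Fin n → Bool) → ℕ → Fin n → Fin n → Bool
reach adj zero    x y = ⌊ x ≟ y ⌋
reach adj (suc k) x y = reach adj k x y ∨ any (λ w → reach adj k x w ∧ adj w y) (allFin _)

isAt : {n : ℕ} → (Fin n → Fin n → Bool) → ℕ → Fin n → Fin n → Bool
isAt adj zero    x y = reach adj zero x y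
isAt adj (suc i) x y = reach adj (suc i) x y ∧ not (reach adj i x y)

record SimpleConnectedGraph (n : ℕ) : Set where
  field
    adj       : Fin n → Fin n → Bool
    symmetric : ∀ x y → adj x y ≡ adj y x
    irrefl    : ∀ x → adj x x ≡ false
    connected : ∀ x y → ∃ λ k → reach adj k x y ≡ true

module _ {n : ℕ} (G : SimpleConnectedGraph n) where
  open SimpleConnectedGraph G

  Γ : ℕ → Fin n → Fin n → Bool
  Γ = isAt adj

  cntAdj : ℕ → Fin n → Fin n → ℕ
  cntAdj j x y = length (filterᵇ (λ w → Γ j x w ∧ adj y w) (allFin n))

  -- |Γ_{i-1}(x) ∩ Γ_1(y)|  (for i = 0 this is 0, as Γ_{-1}(x) = ∅)
  cNum : ℕ → Fin n → Fin n → ℕ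
  cNum zero    x y = 0
  cNum (suc i) x y = cntAdj i x y
  aNum : ℕ → Fin n → Fin n → ℕ
  aNum i x y = cntAdj i x y
  bNum : ℕ → Fin n → Fin n → ℕ
  bNum i x y = cntAdj (suc i) x y

  Ecc : Fin n → ℕ → Set
  Ecc x e = (∃ λ w → Γ e x w ≡ true) × (∀ w j → Γ j x w ≡ true → j ≤ e)

  DistanceRegularized : Fin n → Set
  DistanceRegularized x = ∀ i y y' → Γ i x y ≡ true → Γ i x y' ≡ true →
    (cNum i x y ≡ cNum i x y') × (aNum i x y ≡ aNum i x y') × (bNum i x y ≡ bNum i x y')

  SameIntersectionArray : Fin n → Fin n → Set
  SameIntersectionArray x x' = (∀ e → Ecc x e → Ecc x' e) ×
    (∀ i y y' → Γ i x y ≡ true → Γ i x' y' ≡ true →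
      (cNum i x y ≡ cNum i x' y') × (aNum i x y ≡ aNum i x' y') × (bNum i x y ≡ bNum i x' y'))

  -- Distance-biregular with bipartition given by colour: Y = colour false, Y' = colour true.
  record DistanceBiregular (colour : Fin n → Bool) : Set where
    field
      bipartite    : ∀ x y → adj x y ≡ true → colour x ≢ colour y
      regularized  : ∀ x → DistanceRegularized x
      sameClass    : ∀ x x' → colour x ≡ colour x' → SameIntersectionArray x x'
      diffClass    : ∀ x x' → colour x ≢ colour x' → ¬ SameIntersectionArray x x'

-- Counting from both ends the pairs (u , w) with x' ∼ u, w ∼ z and d(u , w) fixed gives
-- c_{i+1} c_i = c'_{i+1} c'_i for even i (with z = z₂') and b_i b_{i+1} = b'_i b'_{i+1} for
-- odd i (with z = z₁'); the parity of i decides whether u and w lie in the colour classes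
-- that turn both counts into products of intersection numbers.  As c_{i+1}, c'_{i+1}, b_i,
-- b'_i are positive, an identity d·a = b·c makes a compare with b exactly as c with d, which
-- is the claim for even i.  For odd i, the degree k = c_j + b_j (a_j = 0 since the graph is
-- bipartite) is constant on each colour class, and z₁, z₂' lie in one class and z₁', z₂ in
-- the other; so c_i + b_i = c'_{i+1} + b'_{i+1} and c'_i + b'_i = c_{i+1} + b_{i+1}, which
-- transfers the comparison of the b's to the c's.

module Submission where

open import Defs
open import Data.Nat using (ℕ; zero; suc; _+_; _*_; _≤_; _<_; _∸_; _≤?_; z≤n; s≤s; s≤s⁻¹)
open import Data.Nat.Properties
  using ( ≤-antisym; ≤⇒≤′; m≤n⇒m<n∨m≡n; m<n⇒m<1+n; n<1+n; <⇒≢; >⇒≢; ≰⇒>; m<1+n⇒m≤n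
        ; <-irrefl; +-suc; +-cancelˡ-≡; +-cancelʳ-≡; +-mono-<-≤; +-mono-≤-<; +-identityʳ
        ; *-comm; *-zeroʳ; *-identityˡ; *-cancelˡ-≡; *-cancelˡ-<; *-monoʳ-<
        ; +-*-semiring; module ≤-Reasoning )
open import Data.Nat.Base using (_≤′_; ≤′-reflexive; ≤′-step)
open import Data.Nat.Solver using (module +-*-Solver)
open import Data.Bool using (Bool; true; false; _∧_; _∨_; not; _xor_; T?)
open import Data.Bool.Properties
  using (T-≡; ¬-not; not-¬; not-injective; ⇔→≡; ∧-zeroʳ; ∧-identityʳ; ∨-zeroʳ; not-involutive; not-distribʳ-xor; xor-identityʳ)
open import Data.Bool.ListAction using (any)
open import Data.Fin using (Fin)
open import Data.List using (length; filterᵇ; allFin; tabulate)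
open import Data.List.Membership.Propositional using (_∈_; lose)
open import Data.List.Membership.Propositional.Properties using (∈-allFin; ∈-filter⁺; ∈-length)
open import Data.List.Relation.Unary.Any using (satisfied)
open import Data.List.Relation.Unary.Any.Properties using (any⁺; any⁻)
open import Data.Product using (∃; _×_; _,_; proj₁; proj₂)
open import Data.Sum using (_⊎_; inj₁; inj₂)
open import Function.Base using (_∘_; id)
open import Function.Bundles using (_⇔_; mk⇔; Equivalence)
import Function.Properties.Equivalence as ⇔
open import Relation.Nullary using (yes; no; contradiction)
open import Relation.Binary.PropositionalEquality
  using (_≡_; _≢_; refl; sym; trans; cong; cong₂; subst; module ≡-Reasoning)
open import Algebra.Properties.Semiring.Sum +-*-semiring
  using (sum-syntax; sum-cong-≗; sum-replicate-zero; ∑-comm; ∑-distrib-+; *-distribˡ-sum; *-distribʳ-sum)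

SameOrder : ℕ → ℕ → ℕ → ℕ → Set
SameOrder a b c d = (b ≡ a ⇔ d ≡ c) × (a < b ⇔ c < d)

+-≡⇔ : ∀ {a a' b b'} → a + a' ≡ b + b' → (b ≡ a ⇔ a' ≡ b')
+-≡⇔ {a} {a'} {b} {b'} eq = mk⇔
  (λ { refl → +-cancelˡ-≡ b a' b' eq })
  (λ { refl → sym (+-cancelʳ-≡ a' a b eq) })

+-<⇔ : ∀ {a a' b b'} → a + a' ≡ b + b' → (a < b ⇔ b' < a')
+-<⇔ eq = mk⇔
  (λ a<b → ≰⇒> λ a'≤b' → <-irrefl eq (+-mono-<-≤ a<b a'≤b'))
  (λ b'<a' → ≰⇒> λ b≤a → <-irrefl (sym eq) (+-mono-≤-< b≤a b'<a'))

SameOrder-complement : ∀ {a a' b b' c c' d d'} → a + a' ≡ b + b' → c + c' ≡ d + d' →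
  SameOrder d' c' b' a' → SameOrder a b c d
SameOrder-complement eq₁ eq₂ (≡⇔ , <⇔) =
  ⇔.trans (+-≡⇔ eq₁) (⇔.trans (⇔.sym ≡⇔) (⇔.sym (+-≡⇔ eq₂))) ,
  ⇔.trans (+-<⇔ eq₁) (⇔.trans (⇔.sym <⇔) (⇔.sym (+-<⇔ eq₂)))

*-sameOrder : ∀ {a b c d} → d * a ≡ b * c → 0 < b → 0 < d → SameOrder a b c d
*-sameOrder {a} {b@(suc _)} {c} {d@(suc _)} eq _ _ = mk⇔ ≡⇒ ≡⇐ , mk⇔ <⇒ <⇐
  where
  open ≤-Reasoning
  ≡⇒ : b ≡ a → d ≡ c
  ≡⇒ refl = *-cancelˡ-≡ d c b (trans (*-comm b d) eq)
  ≡⇐ : d ≡ c → b ≡ a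
  ≡⇐ refl = sym (*-cancelˡ-≡ a b d (trans eq (*-comm b d)))
  <⇒ : a < b → c < d
  <⇒ a<b = *-cancelˡ-< b c d (begin-strict
    b * c ≡⟨ sym eq ⟩
    d * a <⟨ *-monoʳ-< d a<b ⟩
    d * b ≡⟨ *-comm d b ⟩
    b * d ∎)
  <⇐ : c < d → a < b
  <⇐ c<d = *-cancelˡ-< d a b (begin-strict
    d * a ≡⟨ eq ⟩
    b * c <⟨ *-monoʳ-< b c<d ⟩
    b * d ≡⟨ *-comm b d ⟩
    d * b ∎)

indicator : Bool → ℕ
indicator true  = 1
indicator false = 0

indicator-∧ : ∀ a b → indicator (a ∧ b) ≡ indicator a * indicator b
indicator-∧ true  true  = refl
indicator-∧ true  false = refl
indicator-∧ false b     = refl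

indicator-cases : ∀ {b m K} → (b ≡ true → m ≡ K) → (b ≢ true → m ≡ 0) → m ≡ indicator b * K
indicator-cases {true}  {K = K} t _ = trans (t refl) (sym (+-identityʳ K))
indicator-cases {false}         _ f = f (λ ())

∧-intro : ∀ {a b} → a ≡ true → b ≡ true → a ∧ b ≡ true
∧-intro refl refl = refl

∧-elim : ∀ {a b} → a ∧ b ≡ true → a ≡ true × b ≡ true
∧-elim {true} {true} _ = refl , refl

any≡true⁺ : ∀ {A : Set} (p : A → Bool) {x xs} → x ∈ xs → p x ≡ true → any p xs ≡ true
any≡true⁺ p x∈xs px = Equivalence.to T-≡ (any⁺ p (lose x∈xs (Equivalence.from T-≡ px)))

any≡true⁻ : ∀ {A : Set} (p : A → Bool) xs → any p xs ≡ true → ∃ λ x → p x ≡ true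
any≡true⁻ p xs e with satisfied (any⁻ p xs (Equivalence.from T-≡ e))
... | x , px = x , Equivalence.to T-≡ px

length-filterᵇ-tabulate : ∀ {A : Set} {m} (p : A → Bool) (f : Fin m → A) →
  length (filterᵇ p (tabulate f)) ≡ ∑[ i < m ] indicator (p (f i))
length-filterᵇ-tabulate {m = zero}  p f = refl
length-filterᵇ-tabulate {m = suc m} p f with p (f Fin.zero)
... | true  = cong suc (length-filterᵇ-tabulate p (f ∘ Fin.suc))
... | false = length-filterᵇ-tabulate p (f ∘ Fin.suc)

module _ {n : ℕ} where

  count : (Fin n → Bool) → ℕ
  count p = length (filterᵇ p (allFin n))

  count≡∑ : ∀ p → count p ≡ ∑[ w < n ] indicator (p w)
  count≡∑ p = length-filterᵇ-tabulate p id

  count-pos : ∀ {p} w → p w ≡ true → 0 < count p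
  count-pos {p} w pw = ∈-length (∈-filter⁺ (T? ∘ p) (∈-allFin w) (Equivalence.from T-≡ pw))

  count-zero : ∀ {p} → (∀ w → p w ≢ true) → count p ≡ 0
  count-zero {p} none = begin
    count p                         ≡⟨ count≡∑ p ⟩
    ∑[ w < n ] indicator (p w)      ≡⟨ sum-cong-≗ (λ w → cong indicator (¬-not (none w))) ⟩
    ∑[ w < n ] 0                    ≡⟨ sum-replicate-zero n ⟩
    0                               ∎
    where open ≡-Reasoning

  count-+ : ∀ {p q r} → (∀ w → indicator (p w) ≡ indicator (q w) + indicator (r w)) →
    count p ≡ count q + count r
  count-+ {p} {q} {r} split = begin
    count p                                               ≡⟨ count≡∑ p ⟩
    ∑[ w < n ] indicator (p w)                            ≡⟨ sum-cong-≗ split ⟩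
    ∑[ w < n ] (indicator (q w) + indicator (r w))        ≡⟨ ∑-distrib-+ (indicator ∘ q) (indicator ∘ r) ⟩
    ∑[ w < n ] indicator (q w) + ∑[ w < n ] indicator (r w) ≡⟨ cong₂ _+_ (count≡∑ q) (count≡∑ r) ⟨
    count q + count r                                     ∎
    where open ≡-Reasoning

j≤k≤2+j⇒k≡j∨1+j∨2+j : ∀ {j k} → j ≤ k → k ≤ suc (suc j) → k ≡ j ⊎ k ≡ suc j ⊎ k ≡ suc (suc j)
j≤k≤2+j⇒k≡j∨1+j∨2+j j≤k k≤2+j with m≤n⇒m<n∨m≡n k≤2+j
... | inj₂ k≡2+j = inj₂ (inj₂ k≡2+j)
... | inj₁ (s≤s k≤1+j) with m≤n⇒m<n∨m≡n k≤1+j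
...   | inj₂ k≡1+j    = inj₂ (inj₁ k≡1+j)
...   | inj₁ (s≤s k≤j) = inj₁ (≤-antisym k≤j j≤k)

module Distances {n : ℕ} (G : SimpleConnectedGraph n) where
  open SimpleConnectedGraph G

  adj-sym : ∀ {x y} → adj x y ≡ true → adj y x ≡ true
  adj-sym {x} {y} a = trans (symmetric y x) a

  reach-zero : ∀ x y → reach adj 0 x y ≡ true → x ≡ y
  reach-zero x y r with x Data.Fin.≟ y
  ... | yes x≡y = x≡y

  reach-refl : ∀ x → reach adj 0 x x ≡ true
  reach-refl x with x Data.Fin.≟ x
  ... | yes _  = refl
  ... | no x≢x = contradiction refl x≢x

  reach-suc⁺ : ∀ k x y → reach adj k x y ≡ true ⊎ (∃ λ w → reach adj k x w ≡ true × adj w y ≡ true) →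
    reach adj (suc k) x y ≡ true
  reach-suc⁺ k x y (inj₁ r) rewrite r = refl
  reach-suc⁺ k x y (inj₂ (w , r , a)) =
    trans (cong (reach adj k x y ∨_) (any≡true⁺ _ (∈-allFin w) (∧-intro r a))) (∨-zeroʳ _)

  reach-suc⁻ : ∀ k x y → reach adj (suc k) x y ≡ true →
    reach adj k x y ≡ true ⊎ ∃ λ w → reach adj k x w ≡ true × adj w y ≡ true
  reach-suc⁻ k x y r with reach adj k x y
  ... | true  = inj₁ refl
  ... | false with any≡true⁻ _ (allFin n) r
  ...   | w , pw = inj₂ (w , ∧-elim pw)

  reach-step : ∀ k x w y → reach adj k x w ≡ true → adj w y ≡ true → reach adj (suc k) x y ≡ true
  reach-step k x w y r a = reach-suc⁺ k x y (inj₂ (w , r , a))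

  reach-mono : ∀ {k l} x y → k ≤ l → reach adj k x y ≡ true → reach adj l x y ≡ true
  reach-mono x y k≤l = go (≤⇒≤′ k≤l)
    where
    go : ∀ {k l} → k ≤′ l → reach adj k x y ≡ true → reach adj l x y ≡ true
    go (≤′-reflexive refl)     r = r
    go {l = suc l} (≤′-step k≤l) r = reach-suc⁺ l x y (inj₁ (go k≤l r))

  reach-trans : ∀ i j x y z → reach adj i x y ≡ true → reach adj j y z ≡ true → reach adj (i + j) x z ≡ true
  reach-trans i zero x y z r s rewrite +-identityʳ i | reach-zero y z s = r
  reach-trans i (suc j) x y z r s rewrite +-suc i j with reach-suc⁻ j y z s
  ... | inj₁ s'           = reach-suc⁺ (i + j) x z (inj₁ (reach-trans i j x y z r s'))
  ... | inj₂ (w , s' , a) = reach-step (i + j) x w z (reach-trans i j x y w r s') a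

  reach-sym : ∀ k x y → reach adj k x y ≡ true → reach adj k y x ≡ true
  reach-sym zero x y r rewrite reach-zero x y r = reach-refl y
  reach-sym (suc k) x y r with reach-suc⁻ k x y r
  ... | inj₁ r'           = reach-suc⁺ k y x (inj₁ (reach-sym k x y r'))
  ... | inj₂ (w , r' , a) = reach-trans 1 k y w x (reach-step 0 y y w (reach-refl y) (adj-sym a)) (reach-sym k x w r')

  Γ⇒reach : ∀ i x y → Γ G i x y ≡ true → reach adj i x y ≡ true
  Γ⇒reach zero    x y e = e
  Γ⇒reach (suc i) x y e = proj₁ (∧-elim {reach adj (suc i) x y} e)

  Γ-suc⇒¬reach : ∀ i x y → Γ G (suc i) x y ≡ true → reach adj i x y ≢ true
  Γ-suc⇒¬reach i x y e r = not-¬ r (not-injective (proj₂ (∧-elim {reach adj (suc i) x y} e)))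

  reach⇒Γ-suc : ∀ i x y → reach adj (suc i) x y ≡ true → reach adj i x y ≢ true → Γ G (suc i) x y ≡ true
  reach⇒Γ-suc i x y r nr = ∧-intro r (cong not (¬-not nr))

  Γ-minimal : ∀ i k x y → Γ G i x y ≡ true → reach adj k x y ≡ true → i ≤ k
  Γ-minimal zero    k x y _ _ = z≤n
  Γ-minimal (suc i) k x y e r with suc i ≤? k
  ... | yes i<k = i<k
  ... | no  i≮k = contradiction (reach-mono x y (m<1+n⇒m≤n (≰⇒> i≮k)) r) (Γ-suc⇒¬reach i x y e)

  Γ-unique : ∀ i j x y → Γ G i x y ≡ true → Γ G j x y ≡ true → i ≡ j
  Γ-unique i j x y ei ej =
    ≤-antisym (Γ-minimal i j x y ei (Γ⇒reach j x y ej)) (Γ-minimal j i x y ej (Γ⇒reach i x y ei))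

  Γ-exclusive : ∀ i j x y → Γ G i x y ≡ true → i ≢ j → Γ G j x y ≢ true
  Γ-exclusive i j x y ei i≢j ej = i≢j (Γ-unique i j x y ei ej)

  Γ-≤-antisym : ∀ k i x y → Γ G k x y ≡ true → k ≤ i → i ≤ k → Γ G i x y ≡ true
  Γ-≤-antisym k i x y e k≤i i≤k = subst (λ j → Γ G j x y ≡ true) (≤-antisym k≤i i≤k) e

  reach⇒Γ : ∀ k x y → reach adj k x y ≡ true → ∃ λ i → Γ G i x y ≡ true
  reach⇒Γ zero    x y r = 0 , r
  reach⇒Γ (suc k) x y r with reach adj k x y Data.Bool.≟ true
  ... | yes r' = reach⇒Γ k x y r'
  ... | no  r' = suc k , reach⇒Γ-suc k x y r r'

  Γ-total : ∀ x y → ∃ λ i → Γ G i x y ≡ true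
  Γ-total x y with connected x y
  ... | k , r = reach⇒Γ k x y r

  Γ-sym : ∀ i x y → Γ G i x y ≡ true → Γ G i y x ≡ true
  Γ-sym i x y e with Γ-total y x
  ... | j , e' = Γ-≤-antisym j i y x e'
    (Γ-minimal j i y x e' (reach-sym i x y (Γ⇒reach i x y e)))
    (Γ-minimal i j x y e (reach-sym j y x (Γ⇒reach j y x e')))

  Γ-comm : ∀ i x y → Γ G i x y ≡ Γ G i y x
  Γ-comm i x y = ⇔→≡ (mk⇔ (Γ-sym i x y) (Γ-sym i y x))

  adj⇒Γ₁ : ∀ x y → adj x y ≡ true → Γ G 1 x y ≡ true
  adj⇒Γ₁ x y a = reach⇒Γ-suc 0 x y (reach-step 0 x x y (reach-refl x) a)
    (λ r → not-¬ (irrefl x) (subst (λ v → adj x v ≡ true) (sym (reach-zero x y r)) a))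

  Γ-adj-≤ : ∀ i k x y z → Γ G i x y ≡ true → adj y z ≡ true → Γ G k x z ≡ true → k ≤ suc i
  Γ-adj-≤ i k x y z e a e' = Γ-minimal k (suc i) x z e' (reach-step i x y z (Γ⇒reach i x y e) a)

  Γ-pred : ∀ i x y → Γ G (suc i) x y ≡ true → ∃ λ w → Γ G i x w ≡ true × adj w y ≡ true
  Γ-pred i x y e with reach-suc⁻ i x y (Γ⇒reach (suc i) x y e)
  ... | inj₁ r = contradiction r (Γ-suc⇒¬reach i x y e)
  ... | inj₂ (w , r , a) with Γ-total x w
  ...   | d , e' = w , Γ-≤-antisym d i x w e' (Γ-minimal d i x w e' r) (s≤s⁻¹ (Γ-adj-≤ d (suc i) x w y e' a e)) , a

  Γ-neighbour : ∀ j a y w → Γ G (suc j) a y ≡ true → adj y w ≡ true →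
    Γ G j a w ≡ true ⊎ Γ G (suc j) a w ≡ true ⊎ Γ G (suc (suc j)) a w ≡ true
  Γ-neighbour j a y w e ayw with Γ-total a w
  ... | k , e' with j≤k≤2+j⇒k≡j∨1+j∨2+j (s≤s⁻¹ (Γ-adj-≤ k (suc j) a w y e' (adj-sym ayw) e)) (Γ-adj-≤ (suc j) k a y w e ayw e')
  ...   | inj₁ refl          = inj₁ e'
  ...   | inj₂ (inj₁ refl)   = inj₂ (inj₁ e')
  ...   | inj₂ (inj₂ refl)   = inj₂ (inj₂ e')

module IntersectionNumbers {n : ℕ} (G : SimpleConnectedGraph n) where
  open SimpleConnectedGraph G
  open Distances G

  degree : Fin n → ℕ
  degree y = bNum G 0 y y

  cNum-suc-pos : ∀ i x z → Γ G (suc i) x z ≡ true → 0 < cNum G (suc i) x z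
  cNum-suc-pos i x z e with Γ-pred i x z e
  ... | w , ew , a = count-pos w (∧-intro ew (adj-sym a))

  bNum-pos-somewhere : ∀ i x y → Γ G (suc i) x y ≡ true → ∃ λ w → Γ G i x w ≡ true × 0 < bNum G i x w
  bNum-pos-somewhere i x y e with Γ-pred i x y e
  ... | w , ew , a = w , ew , count-pos y (∧-intro e a)

  neighbourSum : (Fin n → ℕ) → Fin n → ℕ
  neighbourSum f x = ∑[ u < n ] (indicator (adj x u) * f u)

  neighbourSum-restrict : ∀ {f x K} (P : Fin n → Bool) → (∀ u → adj x u ≡ true → f u ≡ indicator (P u) * K) →
    neighbourSum f x ≡ count (λ u → P u ∧ adj x u) * K
  neighbourSum-restrict {f} {x} {K} P onNeighbours = begin
    ∑[ u < n ] (indicator (adj x u) * f u)      ≡⟨ sum-cong-≗ pointwise ⟩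
    ∑[ u < n ] (indicator (P u ∧ adj x u) * K)  ≡⟨ *-distribʳ-sum K (λ u → indicator (P u ∧ adj x u)) ⟨
    ∑[ u < n ] indicator (P u ∧ adj x u) * K    ≡⟨ cong (_* K) (count≡∑ (λ u → P u ∧ adj x u)) ⟨
    count (λ u → P u ∧ adj x u) * K             ∎
    where
    open ≡-Reasoning
    pointwise : ∀ u → indicator (adj x u) * f u ≡ indicator (P u ∧ adj x u) * K
    pointwise u with adj x u in a
    ... | false rewrite ∧-zeroʳ (P u) = refl
    ... | true  rewrite ∧-identityʳ (P u) = trans (*-identityˡ (f u)) (onNeighbours u a)

  neighbourSum-zero : ∀ x → neighbourSum (λ _ → 0) x ≡ 0
  neighbourSum-zero x = trans (sum-cong-≗ (λ u → *-zeroʳ (indicator (adj x u)))) (sum-replicate-zero n)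

  neighbourSum-cntAdj : ∀ m x z → neighbourSum (λ u → cntAdj G m u z) x ≡
    ∑[ u < n ] ∑[ w < n ] (indicator (adj x u) * indicator (Γ G m u w ∧ adj z w))
  neighbourSum-cntAdj m x z = sum-cong-≗ λ u →
    trans (cong (indicator (adj x u) *_) (count≡∑ (λ w → Γ G m u w ∧ adj z w)))
          (*-distribˡ-sum (indicator (adj x u)) (λ w → indicator (Γ G m u w ∧ adj z w)))

  -- Both sides count the pairs (u , w) with x ∼ u, w ∼ z and d(u , w) = m.
  neighbourSum-cntAdj-swap : ∀ m x z →
    neighbourSum (λ u → cntAdj G m u z) x ≡ neighbourSum (λ w → cntAdj G m w x) z
  neighbourSum-cntAdj-swap m x z = begin
    neighbourSum (λ u → cntAdj G m u z) x  ≡⟨ neighbourSum-cntAdj m x z ⟩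
    ∑[ u < n ] ∑[ w < n ] walks u w        ≡⟨ ∑-comm walks ⟩
    ∑[ w < n ] ∑[ u < n ] walks u w        ≡⟨ sum-cong-≗ (λ w → sum-cong-≗ (reverse w)) ⟩
    ∑[ w < n ] ∑[ u < n ] (indicator (adj z w) * indicator (Γ G m w u ∧ adj x u))  ≡⟨ neighbourSum-cntAdj m z x ⟨
    neighbourSum (λ w → cntAdj G m w x) z  ∎
    where
    open ≡-Reasoning
    open +-*-Solver
    walks : Fin n → Fin n → ℕ
    walks u w = indicator (adj x u) * indicator (Γ G m u w ∧ adj z w)
    reverse : ∀ w u → walks u w ≡ indicator (adj z w) * indicator (Γ G m w u ∧ adj x u)
    reverse w u rewrite indicator-∧ (Γ G m u w) (adj z w) | indicator-∧ (Γ G m w u) (adj x u) | Γ-comm m w u =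
      solve 3 (λ a g c → a :* (g :* c) := c :* (g :* a)) refl
        (indicator (adj x u)) (indicator (Γ G m u w)) (indicator (adj z w))

  neighbourSum-cNum-swap : ∀ i x z → neighbourSum (λ u → cNum G i u z) x ≡ neighbourSum (λ w → cNum G i w x) z
  neighbourSum-cNum-swap zero    x z = trans (neighbourSum-zero x) (sym (neighbourSum-zero z))
  neighbourSum-cNum-swap (suc i) x z = neighbourSum-cntAdj-swap i x z

  cNum-vanishes : ∀ i x z u → Γ G (suc i) x z ≡ true → adj x u ≡ true → Γ G i z u ≢ true → cNum G i u z ≡ 0
  cNum-vanishes zero    x z u _ _ _   = refl
  cNum-vanishes (suc i) x z u e a far = count-zero λ w uwz → 
    let uw , wz = ∧-elim {Γ G i u w} uwz
        k , zu = Γ-total z u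
    in far (Γ-≤-antisym k (suc i) z u zu
             (Γ-adj-≤ i k u w z uw (adj-sym wz) (Γ-sym k z u zu))
             (s≤s⁻¹ (Γ-adj-≤ k (suc (suc i)) z u x zu (adj-sym a) (Γ-sym (suc (suc i)) x z e))))

  bNum-vanishes : ∀ i x z u → Γ G i x z ≡ true → adj x u ≡ true → Γ G (suc i) z u ≢ true → bNum G (suc i) u z ≡ 0
  bNum-vanishes i x z u e a far = count-zero λ w uwz →
    let uw , wz = ∧-elim {Γ G (suc (suc i)) u w} uwz
        k , zu = Γ-total z u
    in far (Γ-≤-antisym k (suc i) z u zu
             (Γ-adj-≤ i k z x u (Γ-sym i x z e) a zu)
             (s≤s⁻¹ (Γ-adj-≤ k (suc (suc i)) u z w (Γ-sym k z u zu) wz uw)))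

  cNum-double-count : ∀ i x z {K L} → Γ G (suc i) x z ≡ true →
    (∀ u → adj x u ≡ true → Γ G i z u ≡ true → cNum G i u z ≡ K) →
    (∀ w → adj z w ≡ true → Γ G i x w ≡ true → cNum G i w x ≡ L) →
    cNum G (suc i) z x * K ≡ cNum G (suc i) x z * L
  cNum-double-count i x z {K} {L} e atK atL = begin
    cNum G (suc i) z x * K               ≡⟨ neighbourSum-restrict (Γ G i z) fromX ⟨
    neighbourSum (λ u → cNum G i u z) x  ≡⟨ neighbourSum-cNum-swap i x z ⟩
    neighbourSum (λ w → cNum G i w x) z  ≡⟨ neighbourSum-restrict (Γ G i x) fromZ ⟩
    cNum G (suc i) x z * L               ∎
    where
    open ≡-Reasoning
    fromX : ∀ u → adj x u ≡ true → cNum G i u z ≡ indicator (Γ G i z u) * K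
    fromX u a = indicator-cases (atK u a) (cNum-vanishes i x z u e a)
    fromZ : ∀ w → adj z w ≡ true → cNum G i w x ≡ indicator (Γ G i x w) * L
    fromZ w a = indicator-cases (atL w a) (cNum-vanishes i z x w (Γ-sym (suc i) x z e) a)

  bNum-double-count : ∀ i x z {K L} → Γ G i x z ≡ true →
    (∀ u → adj x u ≡ true → Γ G (suc i) z u ≡ true → bNum G (suc i) u z ≡ K) →
    (∀ w → adj z w ≡ true → Γ G (suc i) x w ≡ true → bNum G (suc i) w x ≡ L) →
    bNum G i z x * K ≡ bNum G i x z * L
  bNum-double-count i x z {K} {L} e atK atL = begin
    bNum G i z x * K                           ≡⟨ neighbourSum-restrict (Γ G (suc i) z) fromX ⟨
    neighbourSum (λ u → bNum G (suc i) u z) x  ≡⟨ neighbourSum-cntAdj-swap (suc (suc i)) x z ⟩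
    neighbourSum (λ w → bNum G (suc i) w x) z  ≡⟨ neighbourSum-restrict (Γ G (suc i) x) fromZ ⟩
    bNum G i x z * L                           ∎
    where
    open ≡-Reasoning
    fromX : ∀ u → adj x u ≡ true → bNum G (suc i) u z ≡ indicator (Γ G (suc i) z u) * K
    fromX u a = indicator-cases (atK u a) (bNum-vanishes i x z u e a)
    fromZ : ∀ w → adj z w ≡ true → bNum G (suc i) w x ≡ indicator (Γ G (suc i) x w) * L
    fromZ w a = indicator-cases (atL w a) (bNum-vanishes i z x w (Γ-sym i x z e) a)

parity : ℕ → Bool
parity zero    = false
parity (suc i) = not (parity i)

module Bipartite {n : ℕ} (G : SimpleConnectedGraph n) (colour : Fin n → Bool)
                 (bipartite : ∀ x y → SimpleConnectedGraph.adj G x y ≡ true → colour x ≢ colour y) where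
  open SimpleConnectedGraph G
  open Distances G
  open IntersectionNumbers G

  adj-colour : ∀ x y → adj x y ≡ true → colour y ≡ not (colour x)
  adj-colour x y a = ¬-not (λ eq → bipartite x y a (sym eq))

  Γ-colour : ∀ i x y → Γ G i x y ≡ true → colour y ≡ colour x xor parity i
  Γ-colour zero    x y e rewrite reach-zero x y e = sym (xor-identityʳ (colour y))
  Γ-colour (suc i) x y e with Γ-pred i x y e
  ... | w , xw , wy = begin
    colour y                      ≡⟨ adj-colour w y wy ⟩
    not (colour w)                ≡⟨ cong not (Γ-colour i x w xw) ⟩
    not (colour x xor parity i)   ≡⟨ not-distribʳ-xor (colour x) (parity i) ⟩
    colour x xor not (parity i)   ∎
    where open ≡-Reasoning

  Γ-neighbour-bipartite : ∀ j a y w → Γ G (suc j) a y ≡ true → adj y w ≡ true →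
    Γ G j a w ≡ true ⊎ Γ G (suc (suc j)) a w ≡ true
  Γ-neighbour-bipartite j a y w e yw with Γ-neighbour j a y w e yw
  ... | inj₁ e'        = inj₁ e'
  ... | inj₂ (inj₂ e') = inj₂ e'
  ... | inj₂ (inj₁ e') =
    contradiction (trans (Γ-colour (suc j) a y e) (sym (Γ-colour (suc j) a w e'))) (bipartite y w yw)

  cNum+bNum≡degree : ∀ i a y → Γ G i a y ≡ true → cNum G i a y + bNum G i a y ≡ degree y
  cNum+bNum≡degree zero    a y e rewrite reach-zero a y e = refl
  cNum+bNum≡degree (suc j) a y e = sym (count-+ split)
    where
    split : ∀ w → indicator (Γ G 1 y w ∧ adj y w) ≡
                  indicator (Γ G j a w ∧ adj y w) + indicator (Γ G (suc (suc j)) a w ∧ adj y w)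
    split w with adj y w in yw
    ... | false rewrite ∧-zeroʳ (Γ G 1 y w) | ∧-zeroʳ (Γ G j a w) | ∧-zeroʳ (Γ G (suc (suc j)) a w) = refl
    ... | true rewrite ∧-identityʳ (Γ G 1 y w) | ∧-identityʳ (Γ G j a w) | ∧-identityʳ (Γ G (suc (suc j)) a w)
                    | adj⇒Γ₁ y w yw with Γ-neighbour-bipartite j a y w e yw
    ...   | inj₁ e' rewrite e' | ¬-not (Γ-exclusive j (suc (suc j)) a w e' (<⇒≢ (m<n⇒m<1+n (n<1+n j)))) = refl
    ...   | inj₂ e' rewrite e' | ¬-not (Γ-exclusive (suc (suc j)) j a w e' (>⇒≢ (m<n⇒m<1+n (n<1+n j)))) = refl

module Biregular {n : ℕ} {G : SimpleConnectedGraph n} {colour : Fin n → Bool}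
                 (DB : DistanceBiregular G colour) where
  open SimpleConnectedGraph G
  open DistanceBiregular DB
  open Distances G
  open IntersectionNumbers G
  open Bipartite G colour bipartite

  c-class : ∀ i a y b y' → colour a ≡ colour b → Γ G i a y ≡ true → Γ G i b y' ≡ true →
    cNum G i a y ≡ cNum G i b y'
  c-class i a y b y' ab ay by' = proj₁ (proj₂ (sameClass a b ab) i y y' ay by')

  b-class : ∀ i a y b y' → colour a ≡ colour b → Γ G i a y ≡ true → Γ G i b y' ≡ true →
    bNum G i a y ≡ bNum G i b y'
  b-class i a y b y' ab ay by' = proj₂ (proj₂ (proj₂ (sameClass a b ab) i y y' ay by'))

  degree-class : ∀ y y' → colour y ≡ colour y' → degree y ≡ degree y'
  degree-class y y' yy' = b-class 0 y y y' y' yy' (reach-refl y) (reach-refl y')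

  bNum-pos : ∀ i x z y → Γ G i x z ≡ true → Γ G (suc i) x y ≡ true → 0 < bNum G i x z
  bNum-pos i x z y xz xy with bNum-pos-somewhere i x y xy
  ... | w , xw , pos = subst (0 <_) (proj₂ (proj₂ (regularized x i w z xw xz))) pos

  module _ {x x' : Fin n} (x∈Y : colour x ≡ false) (x'∈Y' : colour x' ≡ true)
           (i : ℕ) (z₁ z₂ z₁' z₂' : Fin n)
           (xz₁ : Γ G i x z₁ ≡ true) (xz₂ : Γ G (suc i) x z₂ ≡ true)
           (x'z₁' : Γ G i x' z₁' ≡ true) (x'z₂' : Γ G (suc i) x' z₂' ≡ true) where

    cᵢ cᵢ₊₁ c'ᵢ c'ᵢ₊₁ bᵢ bᵢ₊₁ b'ᵢ b'ᵢ₊₁ : ℕ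
    cᵢ    = cNum G i x z₁
    cᵢ₊₁  = cNum G (suc i) x z₂
    c'ᵢ   = cNum G i x' z₁'
    c'ᵢ₊₁ = cNum G (suc i) x' z₂'
    bᵢ    = bNum G i x z₁
    bᵢ₊₁  = bNum G (suc i) x z₂
    b'ᵢ   = bNum G i x' z₁'
    b'ᵢ₊₁ = bNum G (suc i) x' z₂'

    adj-Y : ∀ a u → colour a ≡ colour x → adj a u ≡ true → colour u ≡ colour x'
    adj-Y a u aY au = trans (adj-colour a u au) (trans (cong not (trans aY x∈Y)) (sym x'∈Y'))

    adj-Y' : ∀ a u → colour a ≡ colour x' → adj a u ≡ true → colour u ≡ colour x
    adj-Y' a u aY' au = trans (adj-colour a u au) (trans (cong not (trans aY' x'∈Y')) (sym x∈Y))

    colour-z₁ : colour z₁ ≡ parity i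
    colour-z₁ = trans (Γ-colour i x z₁ xz₁) (cong (_xor parity i) x∈Y)

    colour-z₂ : colour z₂ ≡ not (parity i)
    colour-z₂ = trans (Γ-colour (suc i) x z₂ xz₂) (cong (_xor not (parity i)) x∈Y)

    colour-z₁' : colour z₁' ≡ not (parity i)
    colour-z₁' = trans (Γ-colour i x' z₁' x'z₁') (cong (_xor parity i) x'∈Y')

    colour-z₂' : colour z₂' ≡ parity i
    colour-z₂' = trans (Γ-colour (suc i) x' z₂' x'z₂')
                       (trans (cong (_xor not (parity i)) x'∈Y') (not-involutive (parity i)))

    sameOrder-even : parity i ≡ false → SameOrder cᵢ c'ᵢ₊₁ c'ᵢ cᵢ₊₁
    sameOrder-even even = *-sameOrder product (cNum-suc-pos i x' z₂' x'z₂') (cNum-suc-pos i x z₂ xz₂)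
      where
      open ≡-Reasoning
      z₂'∈Y : colour z₂' ≡ colour x
      z₂'∈Y = trans colour-z₂' (trans even (sym x∈Y))
      cᵢ-around-z₂' : ∀ u → adj x' u ≡ true → Γ G i z₂' u ≡ true → cNum G i u z₂' ≡ cᵢ
      cᵢ-around-z₂' u x'u z₂'u = c-class i u z₂' x z₁ (adj-Y' x' u refl x'u) (Γ-sym i z₂' u z₂'u) xz₁
      c'ᵢ-around-x' : ∀ w → adj z₂' w ≡ true → Γ G i x' w ≡ true → cNum G i w x' ≡ c'ᵢ
      c'ᵢ-around-x' w z₂'w x'w = c-class i w x' x' z₁' (adj-Y z₂' w z₂'∈Y z₂'w) (Γ-sym i x' w x'w) x'z₁'
      product : cᵢ₊₁ * cᵢ ≡ c'ᵢ₊₁ * c'ᵢ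
      product = begin
        cᵢ₊₁ * cᵢ                   ≡⟨ cong (_* cᵢ) (c-class (suc i) x z₂ z₂' x' (sym z₂'∈Y) xz₂ (Γ-sym (suc i) x' z₂' x'z₂')) ⟩
        cNum G (suc i) z₂' x' * cᵢ  ≡⟨ cNum-double-count i x' z₂' x'z₂' cᵢ-around-z₂' c'ᵢ-around-x' ⟩
        c'ᵢ₊₁ * c'ᵢ                 ∎

    sameOrder-odd : parity i ≡ true → SameOrder cᵢ c'ᵢ₊₁ c'ᵢ cᵢ₊₁
    sameOrder-odd odd = SameOrder-complement degrees₁ degrees₂
      (*-sameOrder product (bNum-pos i x' z₁' z₂' x'z₁' x'z₂') (bNum-pos i x z₁ z₂ xz₁ xz₂))
      where
      open ≡-Reasoning
      z₁'∈Y : colour z₁' ≡ colour x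
      z₁'∈Y = trans colour-z₁' (trans (cong not odd) (sym x∈Y))
      degrees₁ : cᵢ + bᵢ ≡ c'ᵢ₊₁ + b'ᵢ₊₁
      degrees₁ = begin
        cᵢ + bᵢ       ≡⟨ cNum+bNum≡degree i x z₁ xz₁ ⟩
        degree z₁     ≡⟨ degree-class z₁ z₂' (trans colour-z₁ (sym colour-z₂')) ⟩
        degree z₂'    ≡⟨ cNum+bNum≡degree (suc i) x' z₂' x'z₂' ⟨
        c'ᵢ₊₁ + b'ᵢ₊₁ ∎
      degrees₂ : c'ᵢ + b'ᵢ ≡ cᵢ₊₁ + bᵢ₊₁
      degrees₂ = begin
        c'ᵢ + b'ᵢ     ≡⟨ cNum+bNum≡degree i x' z₁' x'z₁' ⟩
        degree z₁'    ≡⟨ degree-class z₁' z₂ (trans colour-z₁' (sym colour-z₂)) ⟩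
        degree z₂     ≡⟨ cNum+bNum≡degree (suc i) x z₂ xz₂ ⟨
        cᵢ₊₁ + bᵢ₊₁   ∎
      bᵢ₊₁-around-z₁' : ∀ u → adj x' u ≡ true → Γ G (suc i) z₁' u ≡ true → bNum G (suc i) u z₁' ≡ bᵢ₊₁
      bᵢ₊₁-around-z₁' u x'u z₁'u = b-class (suc i) u z₁' x z₂ (adj-Y' x' u refl x'u) (Γ-sym (suc i) z₁' u z₁'u) xz₂
      b'ᵢ₊₁-around-x' : ∀ w → adj z₁' w ≡ true → Γ G (suc i) x' w ≡ true → bNum G (suc i) w x' ≡ b'ᵢ₊₁
      b'ᵢ₊₁-around-x' w z₁'w x'w = b-class (suc i) w x' x' z₂' (adj-Y z₁' w z₁'∈Y z₁'w) (Γ-sym (suc i) x' w x'w) x'z₂'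
      product : bᵢ * bᵢ₊₁ ≡ b'ᵢ * b'ᵢ₊₁
      product = begin
        bᵢ * bᵢ₊₁               ≡⟨ cong (_* bᵢ₊₁) (b-class i x z₁ z₁' x' (sym z₁'∈Y) xz₁ (Γ-sym i x' z₁' x'z₁')) ⟩
        bNum G i z₁' x' * bᵢ₊₁  ≡⟨ bNum-double-count i x' z₁' x'z₁' bᵢ₊₁-around-z₁' b'ᵢ₊₁-around-x' ⟩
        b'ᵢ * b'ᵢ₊₁             ∎

open Biregular using (sameOrder-even; sameOrder-odd)

proposition2p4 : ∀ {n : ℕ} (G : SimpleConnectedGraph n) (colour : Fin n → Bool) →
    DistanceBiregular G colour →
    (x x' : Fin n) → colour x ≡ false → colour x' ≡ true →
    (D D' : ℕ) → Ecc G x D → Ecc G x' D' → 3 ≤ D →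
    (i : ℕ) → 1 ≤ i → i ≤ D ∸ 1 → i ≤ D' ∸ 1 →
    (z₁ z₂ z₁' z₂' : Fin n) →
    Γ G i x z₁ ≡ true → Γ G (suc i) x z₂ ≡ true →
    Γ G i x' z₁' ≡ true → Γ G (suc i) x' z₂' ≡ true →
    -- c_i = cNum G i x z₁,  c_{i+1} = cNum G (suc i) x z₂,
    -- c'_i = cNum G i x' z₁', c'_{i+1} = cNum G (suc i) x' z₂'
    ((cNum G (suc i) x' z₂' ≡ cNum G i x z₁) ⇔ (cNum G (suc i) x z₂ ≡ cNum G i x' z₁'))
    × ((cNum G i x z₁ < cNum G (suc i) x' z₂') ⇔ (cNum G i x' z₁' < cNum G (suc i) x z₂))
-- The bounds on i, D and D' only ensure that z₁, z₂, z₁', z₂' exist; given them, the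
-- identities hold for every i.
proposition2p4 G colour DB x x' x∈Y x'∈Y' _ _ _ _ _ i _ _ _ z₁ z₂ z₁' z₂' xz₁ xz₂ x'z₁' x'z₂'
  with parity i in p
... | false = sameOrder-even DB x∈Y x'∈Y' i z₁ z₂ z₁' z₂' xz₁ xz₂ x'z₁' x'z₂' p
... | true  = sameOrder-odd  DB x∈Y x'∈Y' i z₁ z₂ z₁' z₂' xz₁ xz₂ x'z₁' x'z₂' p
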